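{- Let $\lambda$ be a partition with at most $n$ parts and let $\gamma$ be a gapless $\lambda$-tuple. Then $M:=M_\lambda(\gamma)$ is a $\lambda$-key. Moreover, for each $h\in[r]$ and $j:=\lambda_{q_{h+1}}$, one has $M_{j+1}(q_h)=\gamma_{q_h}$, and if $s\ge0$ denotes the number of elements of $B(M_j)\setminus B(M_{j+1})$ that are less than $\gamma_{q_h}$, then these $s$ elements are the $s$ largest elements of $[\gamma_{q_h}]\setminus B(M_{j+1})$.
   Context: Fix $n\ge1$; $[m]=\{1,\dots,m\}$, $(a,b]=\{a+1,\dots,b\}$. Partition $\lambda=(\lambda_1\ge\cdots\ge\lambda_n\ge0)$; boxes $(j,i)$, $1\le j\le\lambda_1$, $1\le i\le\zeta_j=\#\{i:\lambda_i\ge j\}$. $R_\lambda=\{q_1<\cdots<q_r\}\subseteq[n-1]$ = column lengths less than $n$; $q_0=0$, $q_{r+1}=n$, $p_h=q_h-q_{h-1}$, carrels $(q_{h-1},q_h]$; $\lambda_i$ is constant on carrels, and column $\lambda_{q_{h+1}}$ has length $q_{h+1}$ while column $\lambda_{q_{h+1}}+1$ has length $q_h$. A gapless $\lambda$-tuple is $\gamma\in[n]^n$ with $\gamma_i\ge i$, strictly increasing on each carrel, such that for each $h\in[r]$ with $\gamma_{q_h}>\gamma_{q_h+1}$, $s=\gamma_{q_h}-\gamma_{q_h+1}+1\le p_{h+1}$ and $\gamma_{q_h+t}=\gamma_{q_h}-s+t$, $t=1,\dots,s$. Tableaux of shape $\lambda$: $T_j(i)\in[n]$ strictly increasing down columns,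 weakly along rows; $\mathcal{T}_\lambda$, ordered entrywise. A latent column $0$ with $T_0(i)=i$ ($i\in[n]$) is prepended to each tableau when needed. $B(T_j)$ = set of entries of column $j$ (so $B(T_0)=[n]$). A $\lambda$-key is $Y\in\mathcal{T}_\lambda$ with $B(Y_l)\supseteq B(Y_j)$ whenever $l\le j$. For such $\gamma$, $M_\lambda(\gamma)$ is the entrywise maximum of $\{T\in\mathcal{T}_\lambda: T_{\lambda_i}(i)=\gamma_i\text{ for all }i\text{ with }\lambda_i\ge1\}$ (nonempty and closed under entrywise max). -}

module Defs where

-- Conventions: everything is 1-based and encoded by functions on ℕ.
--   lam : ℕ → ℕ   the partition, only lam 1 … lam n are relevant.
--   γ   : ℕ → ℕ   the tuple, only γ 1 … γ n are relevant.
--   T   : ℕ → ℕ → ℕ  a tableau, T j i = T_j(i) (column j, row i); only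
--         values on boxes (1 ≤ j ≤ lam 1, 1 ≤ i ≤ ζ j) are relevant.

open import Data.Nat using (ℕ; zero; suc; _+_; _∸_; _≤_; _<_; _≤ᵇ_; _≡ᵇ_)
open import Data.Bool using (Bool; true; false; if_then_else_; _∧_; _∨_; not)
open import Data.List using (List; []; _∷_; map; length; upTo)
open import Data.Product using (_×_)
open import Relation.Binary.PropositionalEquality using (_≡_)

ioc : ℕ → ℕ → List ℕ
ioc a b = map (λ k → suc (a + k)) (upTo (b ∸ a))

anyᵇ : (ℕ → Bool) → List ℕ → Bool
anyᵇ P [] = false
anyᵇ P (x ∷ xs) = P x ∨ anyᵇ P xs

filterᵇ : (ℕ → Bool) → List ℕ → List ℕ
filterᵇ P [] = []
filterᵇ P (x ∷ xs) = if P x then x ∷ filterᵇ P xs else filterᵇ P xs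

countᵇ : (ℕ → Bool) → List ℕ → ℕ
countᵇ P xs = length (filterᵇ P xs)

-- list lookup with default 0 (0-based position)
nth : List ℕ → ℕ → ℕ
nth [] k = 0
nth (x ∷ xs) zero = x
nth (x ∷ xs) (suc k) = nth xs k

Partition : ℕ → (ℕ → ℕ) → Set
Partition n lam = ∀ i → 1 ≤ i → suc i ≤ n → lam (suc i) ≤ lam i

-- ζ_j = #{ i ∈ [n] : λ_i ≥ j }  (so ζ_0 = n, the latent column)
ζ : ℕ → (ℕ → ℕ) → ℕ → ℕ
ζ n lam j = countᵇ (λ i → j ≤ᵇ lam i) (ioc 0 n)

Box : ℕ → (ℕ → ℕ) → ℕ → ℕ → Set
Box n lam j i = (1 ≤ j) × (j ≤ lam 1) × (1 ≤ i) × (i ≤ ζ n lam j)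

col : (ℕ → ℕ → ℕ) → ℕ → ℕ → ℕ
col T zero i = i
col T (suc j) i = T (suc j) i

inB : ℕ → (ℕ → ℕ) → (ℕ → ℕ → ℕ) → ℕ → ℕ → Bool
inB n lam T j x = anyᵇ (λ i → col T j i ≡ᵇ x) (ioc 0 (ζ n lam j))

Tableau : ℕ → (ℕ → ℕ) → (ℕ → ℕ → ℕ) → Set
Tableau n lam T =
  (∀ j i → Box n lam j i → (1 ≤ T j i) × (T j i ≤ n))
  × (∀ j i → Box n lam j i → Box n lam j (suc i) → T j i < T j (suc i))
  × (∀ j i → Box n lam j i → Box n lam (suc j) i → T j i ≤ T (suc j) i)

_≤T[_,_]_ : (ℕ → ℕ → ℕ) → ℕ → (ℕ → ℕ) → (ℕ → ℕ → ℕ) → Set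
T ≤T[ n , lam ] U = ∀ j i → Box n lam j i → T j i ≤ U j i

Key : ℕ → (ℕ → ℕ) → (ℕ → ℕ → ℕ) → Set
Key n lam Y =
  Tableau n lam Y
  × (∀ l j → 1 ≤ l → l ≤ j → j ≤ lam 1 →
       ∀ x → inB n lam Y j x ≡ true → inB n lam Y l x ≡ true)

Rlist : ℕ → (ℕ → ℕ) → List ℕ
Rlist n lam =
  filterᵇ (λ k → anyᵇ (λ j → ζ n lam j ≡ᵇ k) (ioc 0 (lam 1))) (ioc 0 (n ∸ 1))

r : ℕ → (ℕ → ℕ) → ℕ
r n lam = length (Rlist n lam)

q : ℕ → (ℕ → ℕ) → ℕ → ℕ
q n lam zero = 0
q n lam (suc h) = if suc h ≤ᵇ r n lam then nth (Rlist n lam) h else n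

p : ℕ → (ℕ → ℕ) → ℕ → ℕ
p n lam zero = 0
p n lam (suc h) = q n lam (suc h) ∸ q n lam h

Gapless : ℕ → (ℕ → ℕ) → (ℕ → ℕ) → Set
Gapless n lam γ =
  (∀ i → 1 ≤ i → i ≤ n → (i ≤ γ i) × (γ i ≤ n))
  × (∀ h → h ≤ r n lam →
       ∀ i → q n lam h < i → suc i ≤ q n lam (suc h) → γ i < γ (suc i))
  × (∀ h → 1 ≤ h → h ≤ r n lam → γ (suc (q n lam h)) < γ (q n lam h) →
       let s = γ (q n lam h) ∸ γ (suc (q n lam h)) + 1 in
       (s ≤ p n lam (suc h))
       × (∀ t → 1 ≤ t → t ≤ s → γ (q n lam h + t) ≡ (γ (q n lam h) ∸ s) + t))

Fits : ℕ → (ℕ → ℕ) → (ℕ → ℕ) → (ℕ → ℕ → ℕ) → Set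
Fits n lam γ T =
  Tableau n lam T × (∀ i → 1 ≤ i → i ≤ n → 1 ≤ lam i → T (lam i) i ≡ γ i)

IsMλ : ℕ → (ℕ → ℕ) → (ℕ → ℕ) → (ℕ → ℕ → ℕ) → Set
IsMλ n lam γ M = Fits n lam γ M × (∀ T → Fits n lam γ T → T ≤T[ n , lam ] M)

-- M_λ(γ) has the closed form  M_j(i) = i + min { γ_k − k : i ≤ k ≤ ζ_j }.  Any fitting tableau satisfies
-- T_j(i) + (k − i) ≤ T_j(k) ≤ γ_k down its columns, so it lies below this formula; conversely the formula
-- is itself a fitting tableau, because γ_k − k is nondecreasing wherever λ is constant, i.e. on each carrel.
-- So a column of M depends only on its length, and two consecutive distinct column lengths are some
-- q_h < q_{h+1}.  Passing from length q_h to q_{h+1}, every new row k has γ_k − k ≥ μ := γ_{q_h+1} − q_h − 1,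
-- so the shorter column's entries stay put up to the first row a (if any) whose minimum over k ≤ q_h exceeds
-- μ, rows i ≥ a drop to i + μ, and the gapless condition at q_h makes the new rows fill the values up to γ_{q_h}.
-- Thus below γ_{q_h} the longer column is (shorter column below a threshold e) ∪ [e, γ_{q_h}]: this gives the
-- key property by chaining columns, and the count characterisation of B(M_j) ∖ B(M_{j+1}) by counting.

module Submission where

open import Defs
open import Data.Nat using (ℕ; zero; suc; pred; _+_; _∸_; _≤_; _<_; _≤ᵇ_; _≡ᵇ_; _⊓_; z≤n; s≤s; _≤?_; _<?_; _≟_)
open import Data.Nat.Properties
open import Algebra.Properties.CommutativeSemigroup +-commutativeSemigroup using (xy∙z≈xz∙y)
open import Data.Bool using (Bool; true; false; _∨_; _∧_; not; T)
open import Data.Bool.Properties using (∨-assoc; ∨-zeroʳ; ∧-conicalʳ; T-≡)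
open import Data.List using (List; []; _∷_; length; applyUpTo; _++_)
open import Data.List.Properties using (map-applyUpTo; applyUpTo-∷ʳ; length-++)
open import Data.Product using (_×_; _,_; proj₁; proj₂; ∃-syntax)
open import Data.Sum using (_⊎_; inj₁; inj₂)
open import Data.Empty using (⊥; ⊥-elim)
open import Relation.Binary.PropositionalEquality
open import Relation.Nullary using (¬_; Dec; yes; no)
open import Relation.Binary.Definitions using (tri<; tri≈; tri>)
open import Function.Bundles using (_⇔_; mk⇔; Equivalence)

≤ᵇ≡true⇒≤ : ∀ a b → (a ≤ᵇ b) ≡ true → a ≤ b
≤ᵇ≡true⇒≤ a b e = ≤ᵇ⇒≤ a b (Equivalence.from T-≡ e)

≤⇒≤ᵇ≡true : ∀ {a b} → a ≤ b → (a ≤ᵇ b) ≡ true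
≤⇒≤ᵇ≡true le = Equivalence.to T-≡ (≤⇒≤ᵇ le)

≰⇒≤ᵇ≡false : ∀ a b → ¬ (a ≤ b) → (a ≤ᵇ b) ≡ false
≰⇒≤ᵇ≡false a b a≰b with a ≤ᵇ b in eq
... | true = ⊥-elim (a≰b (≤ᵇ≡true⇒≤ a b eq))
... | false = refl

≡ᵇ≡true⇒≡ : ∀ a b → (a ≡ᵇ b) ≡ true → a ≡ b
≡ᵇ≡true⇒≡ a b e = ≡ᵇ⇒≡ a b (Equivalence.from T-≡ e)

≡ᵇ-refl : ∀ a → (a ≡ᵇ a) ≡ true
≡ᵇ-refl a = Equivalence.to T-≡ (≡⇒≡ᵇ a a refl)

false≢true : false ≢ true
false≢true ()

∨≡true⇒⊎ : ∀ x y → x ∨ y ≡ true → (x ≡ true) ⊎ (y ≡ true)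
∨≡true⇒⊎ true y e = inj₁ refl
∨≡true⇒⊎ false y e = inj₂ e

ioc≡applyUpTo : ∀ a b → ioc a b ≡ applyUpTo (λ k → suc (a + k)) (b ∸ a)
ioc≡applyUpTo a b = map-applyUpTo (λ x → x) (λ k → suc (a + k)) (b ∸ a)

applyUpTo-cong : ∀ {f g : ℕ → ℕ} → (∀ x → f x ≡ g x) → ∀ d → applyUpTo f d ≡ applyUpTo g d
applyUpTo-cong f≗g zero = refl
applyUpTo-cong f≗g (suc d) = cong₂ _∷_ (f≗g 0) (applyUpTo-cong (λ x → f≗g (suc x)) d)

ioc-empty : ∀ a b → b ≤ a → ioc a b ≡ []
ioc-empty a b b≤a rewrite ioc≡applyUpTo a b | m≤n⇒m∸n≡0 b≤a = refl

ioc-∷ : ∀ a b → a < b → ioc a b ≡ suc a ∷ ioc (suc a) b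
ioc-∷ a (suc b) (s≤s a≤b)
  rewrite ioc≡applyUpTo a (suc b) | ioc≡applyUpTo (suc a) (suc b) | +-∸-assoc 1 a≤b =
  cong₂ _∷_ (cong suc (+-identityʳ a)) (applyUpTo-cong (λ x → cong suc (+-suc a x)) (b ∸ a))

ioc-∷ʳ : ∀ a b → a ≤ b → ioc a (suc b) ≡ ioc a b ++ (suc b ∷ [])
ioc-∷ʳ a b a≤b rewrite ioc≡applyUpTo a (suc b) | ioc≡applyUpTo a b | +-∸-assoc 1 a≤b =
  trans (sym (applyUpTo-∷ʳ (λ k → suc (a + k)) (b ∸ a)))
        (cong (λ z → applyUpTo (λ k → suc (a + k)) (b ∸ a) ++ (suc z ∷ [])) (m+[n∸m]≡n a≤b))

anyᵇ-++ : ∀ P xs ys → anyᵇ P (xs ++ ys) ≡ anyᵇ P xs ∨ anyᵇ P ys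
anyᵇ-++ P [] ys = refl
anyᵇ-++ P (x ∷ xs) ys rewrite anyᵇ-++ P xs ys = sym (∨-assoc (P x) (anyᵇ P xs) (anyᵇ P ys))

anyᵇ-ioc⇒∃ : ∀ P a b → anyᵇ P (ioc a b) ≡ true → ∃[ i ] (a < i × i ≤ b × P i ≡ true)
anyᵇ-ioc⇒∃ P a zero e rewrite ioc-empty a zero z≤n with e
... | ()
anyᵇ-ioc⇒∃ P a (suc b) e with a ≤? b
... | no a≰b rewrite ioc-empty a (suc b) (≰⇒> a≰b) with e
... | ()
anyᵇ-ioc⇒∃ P a (suc b) e | yes a≤b rewrite ioc-∷ʳ a b a≤b | anyᵇ-++ P (ioc a b) (suc b ∷ [])
  with ∨≡true⇒⊎ (anyᵇ P (ioc a b)) _ e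
... | inj₁ e₁ = let (i , a<i , i≤b , Pi) = anyᵇ-ioc⇒∃ P a b e₁ in i , a<i , m≤n⇒m≤1+n i≤b , Pi
... | inj₂ e₂ with P (suc b) in Pb
...   | true = suc b , s≤s a≤b , ≤-refl , Pb
...   | false with e₂
...     | ()

∃⇒anyᵇ-ioc : ∀ P a b i → a < i → i ≤ b → P i ≡ true → anyᵇ P (ioc a b) ≡ true
∃⇒anyᵇ-ioc P a zero i a<i i≤0 Pi = ⊥-elim (<-irrefl refl (≤-trans a<i (≤-trans i≤0 z≤n)))
∃⇒anyᵇ-ioc P a (suc b) i a<i i≤b+1 Pi with a ≤? b
... | no a≰b = ⊥-elim (<-irrefl refl (≤-trans a<i (≤-trans i≤b+1 (≰⇒> a≰b))))
... | yes a≤b rewrite ioc-∷ʳ a b a≤b | anyᵇ-++ P (ioc a b) (suc b ∷ []) with m≤n⇒m<n∨m≡n i≤b+1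
...   | inj₁ (s≤s i≤b) rewrite ∃⇒anyᵇ-ioc P a b i a<i i≤b Pi = refl
...   | inj₂ refl rewrite Pi = ∨-zeroʳ (anyᵇ P (ioc a b))

bit : Bool → ℕ
bit true = 1
bit false = 0

bit-mono : ∀ {x y} → (x ≡ true → y ≡ true) → bit x ≤ bit y
bit-mono {true} x⇒y rewrite x⇒y refl = ≤-refl
bit-mono {false} _ = z≤n

bit≤1 : ∀ x → bit x ≤ 1
bit≤1 true = ≤-refl
bit≤1 false = z≤n

count : (ℕ → Bool) → ℕ → ℕ → ℕ
count P a b = countᵇ P (ioc a b)

filterᵇ-++ : ∀ P xs ys → filterᵇ P (xs ++ ys) ≡ filterᵇ P xs ++ filterᵇ P ys
filterᵇ-++ P [] ys = refl
filterᵇ-++ P (x ∷ xs) ys with P x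
... | true = cong (x ∷_) (filterᵇ-++ P xs ys)
... | false = filterᵇ-++ P xs ys

filterᵇ-false : ∀ xs → filterᵇ (λ _ → false) xs ≡ []
filterᵇ-false [] = refl
filterᵇ-false (x ∷ xs) = filterᵇ-false xs

count-empty : ∀ P a b → b ≤ a → count P a b ≡ 0
count-empty P a b b≤a rewrite ioc-empty a b b≤a = refl

count-∷ʳ : ∀ P a b → a ≤ b → count P a (suc b) ≡ count P a b + bit (P (suc b))
count-∷ʳ P a b a≤b rewrite ioc-∷ʳ a b a≤b | filterᵇ-++ P (ioc a b) (suc b ∷ [])
  | length-++ (filterᵇ P (ioc a b)) {filterᵇ P (suc b ∷ [])} with P (suc b)
... | true = refl
... | false = refl

count-split : ∀ P a m b → a ≤ m → m ≤ b → count P a b ≡ count P a m + count P m b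
count-split P a m zero a≤m m≤0 rewrite n≤0⇒n≡0 m≤0 | count-empty P a 0 z≤n = refl
count-split P a m (suc b) a≤m m≤b+1 with m≤n⇒m<n∨m≡n m≤b+1
... | inj₂ refl rewrite count-empty P (suc b) (suc b) ≤-refl = sym (+-identityʳ _)
... | inj₁ (s≤s m≤b) rewrite count-∷ʳ P a b (≤-trans a≤m m≤b) | count-∷ʳ P m b m≤b
      | count-split P a m b a≤m m≤b = +-assoc (count P a m) (count P m b) _

count-mono : ∀ P Q a b → (∀ i → a < i → i ≤ b → P i ≡ true → Q i ≡ true) → count P a b ≤ count Q a b
count-mono P Q a zero P⇒Q rewrite count-empty P a 0 z≤n = z≤n
count-mono P Q a (suc b) P⇒Q with a ≤? b
... | no a≰b rewrite count-empty P a (suc b) (≰⇒> a≰b) = z≤n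
... | yes a≤b rewrite count-∷ʳ P a b a≤b | count-∷ʳ Q a b a≤b =
  +-mono-≤ (count-mono P Q a b (λ i a<i i≤b → P⇒Q i a<i (m≤n⇒m≤1+n i≤b)))
           (bit-mono (P⇒Q (suc b) (s≤s a≤b) ≤-refl))

count-cong : ∀ P Q a b → (∀ i → a < i → i ≤ b → P i ≡ Q i) → count P a b ≡ count Q a b
count-cong P Q a b P≗Q = ≤-antisym (count-mono P Q a b (λ i a<i i≤b → trans (sym (P≗Q i a<i i≤b))))
                                    (count-mono Q P a b (λ i a<i i≤b → trans (P≗Q i a<i i≤b)))

count-none : ∀ P a b → (∀ i → a < i → i ≤ b → P i ≡ false) → count P a b ≡ 0
count-none P a b none = n≤0⇒n≡0 (subst (count P a b ≤_) (cong length (filterᵇ-false (ioc a b)))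
  (count-mono P (λ _ → false) a b (λ i a<i i≤b → trans (sym (none i a<i i≤b)))))

count-all : ∀ P a b → (∀ i → a < i → i ≤ b → P i ≡ true) → count P a b ≡ b ∸ a
count-all P a zero all rewrite count-empty P a 0 z≤n | 0∸n≡0 a = refl
count-all P a (suc b) all with a ≤? b
... | no a≰b rewrite count-empty P a (suc b) (≰⇒> a≰b) | m≤n⇒m∸n≡0 (≰⇒> a≰b) = refl
... | yes a≤b rewrite count-∷ʳ P a b a≤b | +-∸-assoc 1 a≤b | all (suc b) (s≤s a≤b) ≤-refl
        | count-all P a b (λ i a<i i≤b → all i a<i (m≤n⇒m≤1+n i≤b)) = +-comm (b ∸ a) 1

count≤length : ∀ P a b → count P a b ≤ b ∸ a
count≤length P a zero rewrite count-empty P a 0 z≤n = z≤n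
count≤length P a (suc b) with a ≤? b
... | no a≰b rewrite count-empty P a (suc b) (≰⇒> a≰b) = z≤n
... | yes a≤b rewrite count-∷ʳ P a b a≤b | +-∸-assoc 1 a≤b =
  subst (count P a b + bit (P (suc b)) ≤_) (+-comm (b ∸ a) 1)
        (+-mono-≤ (count≤length P a b) (bit≤1 (P (suc b))))

DownClosed : (ℕ → Bool) → ℕ → Set
DownClosed P m = ∀ i → 1 ≤ i → suc i ≤ m → P (suc i) ≡ true → P i ≡ true

downClosed-below : ∀ P m → DownClosed P m → ∀ k → k ≤ m → P k ≡ true →
                   ∀ i → 1 ≤ i → i ≤ k → P i ≡ true
downClosed-below P m dc zero k≤m Pk i 1≤i i≤0 = ⊥-elim (<-irrefl refl (≤-trans 1≤i i≤0))
downClosed-below P m dc (suc k) k≤m Pk i 1≤i i≤k+1 with m≤n⇒m<n∨m≡n i≤k+1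
... | inj₂ refl = Pk
... | inj₁ (s≤s i≤k) =
  downClosed-below P m dc k (≤-trans (n≤1+n k) k≤m) (dc k (≤-trans 1≤i i≤k) k≤m Pk) i 1≤i i≤k

downClosed-count : ∀ P m → DownClosed P m → ∀ i → 1 ≤ i → i ≤ m → P i ≡ true ⇔ i ≤ count P 0 m
downClosed-count P zero dc i 1≤i i≤0 = ⊥-elim (<-irrefl refl (≤-trans 1≤i i≤0))
downClosed-count P (suc m) dc i 1≤i i≤m+1 with P (suc m) in Pm
... | true = mk⇔ (λ _ → subst (i ≤_) (sym counted) i≤m+1) (λ _ → allP i 1≤i i≤m+1)
  where
  allP : ∀ j → 1 ≤ j → j ≤ suc m → P j ≡ true
  allP = downClosed-below P (suc m) dc (suc m) ≤-refl Pm
  counted : count P 0 (suc m) ≡ suc m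
  counted = count-all P 0 (suc m) allP
... | false rewrite count-∷ʳ P 0 m z≤n | Pm | +-identityʳ (count P 0 m) with m≤n⇒m<n∨m≡n i≤m+1
...   | inj₁ (s≤s i≤m) = downClosed-count P m (λ j 1≤j j<m → dc j 1≤j (m≤n⇒m≤1+n j<m)) i 1≤i i≤m
...   | inj₂ refl = mk⇔ (λ Pi → ⊥-elim (false≢true (trans (sym Pm) Pi)))
                        (λ m+1≤c → ⊥-elim (<-irrefl refl (≤-trans m+1≤c (count≤length P 0 m))))

rangeMin : (ℕ → ℕ) → ℕ → ℕ → ℕ
rangeMin f i zero = f i
rangeMin f i (suc l) = f i ⊓ rangeMin f (suc i) l

rangeMin-≤ : ∀ f i l k → k ≤ l → rangeMin f i l ≤ f (i + k)
rangeMin-≤ f i zero zero _ rewrite +-identityʳ i = ≤-refl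
rangeMin-≤ f i (suc l) zero _ rewrite +-identityʳ i = m⊓n≤m (f i) _
rangeMin-≤ f i (suc l) (suc k) (s≤s k≤l) rewrite +-suc i k =
  ≤-trans (m⊓n≤n (f i) _) (rangeMin-≤ f (suc i) l k k≤l)

rangeMin-greatest : ∀ f i l x → (∀ k → k ≤ l → x ≤ f (i + k)) → x ≤ rangeMin f i l
rangeMin-greatest f i zero x bound = subst (x ≤_) (cong f (+-identityʳ i)) (bound 0 z≤n)
rangeMin-greatest f i (suc l) x bound =
  ⊓-glb (subst (x ≤_) (cong f (+-identityʳ i)) (bound 0 z≤n))
        (rangeMin-greatest f (suc i) l x
          (λ k k≤l → subst (x ≤_) (cong f (+-suc i k)) (bound (suc k) (s≤s k≤l))))

rangeMin-head : ∀ f i l → (∀ k → k ≤ l → f i ≤ f (i + k)) → rangeMin f i l ≡ f i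
rangeMin-head f i l head≤ =
  ≤-antisym (subst (rangeMin f i l ≤_) (cong f (+-identityʳ i)) (rangeMin-≤ f i l 0 z≤n))
            (rangeMin-greatest f i l (f i) head≤)

rangeMin-split : ∀ f i l l' → rangeMin f i (l + suc l') ≡ rangeMin f i l ⊓ rangeMin f (i + suc l) l'
rangeMin-split f i zero l' rewrite +-comm i 1 = refl
rangeMin-split f i (suc l) l' rewrite rangeMin-split f (suc i) l l' | +-suc i (suc l) =
  sym (⊓-assoc (f i) (rangeMin f (suc i) l) _)

rangeMin-antitone : ∀ f i l l' → l ≤ l' → rangeMin f i l' ≤ rangeMin f i l
rangeMin-antitone f i l l' l≤l' =
  rangeMin-greatest f i l _ (λ k k≤l → rangeMin-≤ f i l' k (≤-trans k≤l l≤l'))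

threshold-count : ∀ (P Q : ℕ → Bool) g e → Q g ≡ true →
  (∀ y → 1 ≤ y → y ≤ g → P y ≡ true → (Q y ≡ true × y < e) ⊎ e ≤ y) →
  (∀ y → 1 ≤ y → y ≤ g → e ≤ y → P y ≡ true) →
  ∀ x → 1 ≤ x → x ≤ g → Q x ≡ false →
  (x < g × P x ≡ true) ⇔ (count (λ y → not (Q y)) x g < count (λ y → P y ∧ not (Q y)) 0 (g ∸ 1))
threshold-count P Q zero e _ _ _ x 1≤x x≤0 _ = ⊥-elim (<-irrefl refl (≤-trans 1≤x x≤0))
threshold-count P Q (suc g) e Q[g] low high x@(suc x') 1≤x x≤g+1 Q[x] = by-threshold (e ≤? x)
  where
  open ≤-Reasoning
  nQ PQ : ℕ → Bool
  nQ y = not (Q y)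
  PQ y = P y ∧ not (Q y)

  x≤g : x ≤ g
  x≤g = ≤-pred (≤∧≢⇒< x≤g+1 (λ x≡g+1 → false≢true (trans (sym Q[x]) (trans (cong Q x≡g+1) Q[g]))))

  nQ-drop-g : count nQ x (suc g) ≡ count nQ x g
  nQ-drop-g rewrite count-∷ʳ nQ x g x≤g | Q[g] = +-identityʳ _

  split-at-x : count PQ 0 g ≡ count PQ 0 x + count PQ x g
  split-at-x = count-split PQ 0 x g z≤n x≤g

  by-threshold : Dec (e ≤ x) → (x < suc g × P x ≡ true) ⇔ (count nQ x (suc g) < count PQ 0 g)
  by-threshold (yes e≤x) = mk⇔ (λ _ → N<S) (λ _ → s≤s x≤g , P[x])
    where
    P[x] : P x ≡ true
    P[x] = high x 1≤x x≤g+1 e≤x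
    1≤PQ-below-x : 1 ≤ count PQ 0 x
    1≤PQ-below-x rewrite count-∷ʳ PQ 0 x' z≤n | P[x] | Q[x] = m≤n+m 1 _
    above-x : count PQ x g ≡ count nQ x g
    above-x = count-cong PQ nQ x g λ i x<i i≤g →
      cong (_∧ not (Q i)) (high i (≤-trans 1≤x (<⇒≤ x<i)) (m≤n⇒m≤1+n i≤g) (≤-trans e≤x (<⇒≤ x<i)))
    N<S : count nQ x (suc g) < count PQ 0 g
    N<S = begin-strict
      count nQ x (suc g)           ≡⟨ nQ-drop-g ⟩
      count nQ x g                 <⟨ m<n+m _ 1≤PQ-below-x ⟩
      count PQ 0 x + count nQ x g  ≡⟨ cong (count PQ 0 x +_) above-x ⟨
      count PQ 0 x + count PQ x g  ≡⟨ split-at-x ⟨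
      count PQ 0 g                 ∎
  by-threshold (no e≰x) =
    mk⇔ (λ (_ , P[x]) → ⊥-elim (¬P[x] P[x])) (λ N<S → ⊥-elim (<-irrefl refl (<-≤-trans N<S S≤N)))
    where
    ¬P[x] : P x ≢ true
    ¬P[x] P[x] with low x 1≤x x≤g+1 P[x]
    ... | inj₁ (Q[x]′ , _) = false≢true (trans (sym Q[x]) Q[x]′)
    ... | inj₂ e≤x = e≰x e≤x
    PQ-false : ∀ i → 0 < i → i ≤ x → PQ i ≡ false
    PQ-false i 1≤i i≤x with P i in P[i]
    ... | false = refl
    ... | true with low i 1≤i (≤-trans i≤x x≤g+1) P[i]
    ...   | inj₁ (Q[i] , _) rewrite Q[i] = refl
    ...   | inj₂ e≤i = ⊥-elim (e≰x (≤-trans e≤i i≤x))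
    S≤N : count PQ 0 g ≤ count nQ x (suc g)
    S≤N = begin
      count PQ 0 g                 ≡⟨ split-at-x ⟩
      count PQ 0 x + count PQ x g  ≡⟨ cong (_+ count PQ x g) (count-none PQ 0 x PQ-false) ⟩
      count PQ x g                 ≤⟨ count-mono PQ nQ x g (λ i _ _ → ∧-conicalʳ (P i) _) ⟩
      count nQ x g                 ≡⟨ nQ-drop-g ⟨
      count nQ x (suc g)           ∎

NoneBetween : (ℕ → Bool) → ℕ → ℕ → Set
NoneBetween P u v = ∀ k → u < k → k < v → P k ≡ false

-- Position h of ys is preceded by position h of (a ∷ ys).
HitsIn : (ℕ → Bool) → ℕ → ℕ → List ℕ → Set
HitsIn P a b ys =
  (∀ h → h < length ys →
     nth (a ∷ ys) h < nth ys h × nth ys h ≤ b × P (nth ys h) ≡ true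
     × NoneBetween P (nth (a ∷ ys) h) (nth ys h))
  × NoneBetween P (nth (a ∷ ys) (length ys)) (suc b)

noneBetween-skip : ∀ P a ys h v → P (suc a) ≡ false →
  NoneBetween P (nth (suc a ∷ ys) h) v → NoneBetween P (nth (a ∷ ys) h) v
noneBetween-skip P a ys zero v Pa+1 none k a<k k<v with m≤n⇒m<n∨m≡n a<k
... | inj₁ a+1<k = none k a+1<k k<v
... | inj₂ refl = Pa+1
noneBetween-skip P a ys (suc h) v Pa+1 none = none

nth-∷-mono : ∀ a ys h → nth (a ∷ ys) h ≤ nth (suc a ∷ ys) h
nth-∷-mono a ys zero = n≤1+n a
nth-∷-mono a ys (suc h) = ≤-refl

∸≡suc⇒< : ∀ {a b d} → b ∸ a ≡ suc d → a < b
∸≡suc⇒< {a} {b} b∸a≡d+1 = ≰⇒> (λ b≤a → 0≢1+n (trans (sym (m≤n⇒m∸n≡0 b≤a)) b∸a≡d+1))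

filter-ioc-hits : ∀ P a b → HitsIn P a b (filterᵇ P (ioc a b))
filter-ioc-hits P a b = go (b ∸ a) a refl
  where
  go : ∀ d a → b ∸ a ≡ d → HitsIn P a b (filterᵇ P (ioc a b))
  go zero a b∸a≡0 rewrite ioc-empty a b (m∸n≡0⇒m≤n b∸a≡0) =
    (λ h ()) , λ k a<k k≤b → ⊥-elim (<-irrefl refl (≤-trans a<k (≤-trans (≤-pred k≤b) (m∸n≡0⇒m≤n b∸a≡0))))
  go (suc d) a b∸a≡d+1 = extend (go d (suc a) (trans (sym (pred[m∸n]≡m∸[1+n] b a)) (cong pred b∸a≡d+1)))
    where
    a<b : a < b
    a<b = ∸≡suc⇒< b∸a≡d+1
    ys : List ℕ
    ys = filterᵇ P (ioc (suc a) b)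
    extend : HitsIn P (suc a) b ys → HitsIn P a b (filterᵇ P (ioc a b))
    extend hits rewrite ioc-∷ a b a<b with P (suc a) in Pa+1
    ... | true = (λ { zero _ → ≤-refl , a<b , Pa+1 , λ k a<k k≤a → ⊥-elim (<-irrefl refl (≤-trans a<k (≤-pred k≤a)))
                    ; (suc h) (s≤s h<) → proj₁ hits h h< })
               , proj₂ hits
    ... | false = (λ h h< → let (prev< , ≤b , Ph , none) = proj₁ hits h h< in
                     ≤-<-trans (nth-∷-mono a ys h) prev< , ≤b , Ph , noneBetween-skip P a ys h _ Pa+1 none)
                , noneBetween-skip P a ys (length ys) (suc b) Pa+1 (proj₂ hits)

crossing : ∀ (f : ℕ → ℕ) k R → f 0 < k → k ≤ f (suc R) → ∃[ h ] (h ≤ R × f h < k × k ≤ f (suc h))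
crossing f k zero f0<k k≤f1 = 0 , z≤n , f0<k , k≤f1
crossing f k (suc R) f0<k k≤fR+2 with f (suc R) <? k
... | yes fR+1<k = suc R , ≤-refl , fR+1<k , k≤fR+2
... | no fR+1≮k = let (h , h≤R , below , above) = crossing f k R f0<k (≮⇒≥ fR+1≮k) in
                  h , m≤n⇒m≤1+n h≤R , below , above

module Shape (n : ℕ) (1≤n : 1 ≤ n) (lam : ℕ → ℕ) (part : Partition n lam) where

  lam-antitone : ∀ i i' → 1 ≤ i → i ≤ i' → i' ≤ n → lam i' ≤ lam i
  lam-antitone i i' 1≤i i≤i' i'≤n =
    subst (λ z → lam z ≤ lam i) (m+[n∸m]≡n i≤i')
      (go (i' ∸ i) (subst (_≤ n) (sym (m+[n∸m]≡n i≤i')) i'≤n))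
    where
    go : ∀ d → i + d ≤ n → lam (i + d) ≤ lam i
    go zero _ rewrite +-identityʳ i = ≤-refl
    go (suc d) i+d<n rewrite +-suc i d =
      ≤-trans (part (i + d) (≤-trans 1≤i (m≤m+n i d)) i+d<n) (go d (≤-trans (n≤1+n _) i+d<n))

  lam≤lam₁ : ∀ i → 1 ≤ i → i ≤ n → lam i ≤ lam 1
  lam≤lam₁ i 1≤i i≤n = lam-antitone 1 i ≤-refl 1≤i i≤n

  reaches : ℕ → ℕ → Bool
  reaches j i = j ≤ᵇ lam i

  reaches-downClosed : ∀ j → DownClosed (reaches j) n
  reaches-downClosed j i 1≤i i<n e = ≤⇒≤ᵇ≡true (≤-trans (≤ᵇ≡true⇒≤ j _ e) (part i 1≤i i<n))

  ζ≤n : ∀ j → ζ n lam j ≤ n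
  ζ≤n j = count≤length (reaches j) 0 n

  ≤lam⇒≤ζ : ∀ j i → 1 ≤ i → i ≤ n → j ≤ lam i → i ≤ ζ n lam j
  ≤lam⇒≤ζ j i 1≤i i≤n j≤ =
    Equivalence.to (downClosed-count (reaches j) n (reaches-downClosed j) i 1≤i i≤n) (≤⇒≤ᵇ≡true j≤)

  ≤ζ⇒≤lam : ∀ j i → 1 ≤ i → i ≤ n → i ≤ ζ n lam j → j ≤ lam i
  ≤ζ⇒≤lam j i 1≤i i≤n i≤ =
    ≤ᵇ≡true⇒≤ j (lam i) (Equivalence.from (downClosed-count (reaches j) n (reaches-downClosed j) i 1≤i i≤n) i≤)

  ζ-antitone : ∀ j j' → j ≤ j' → ζ n lam j' ≤ ζ n lam j
  ζ-antitone j j' j≤j' =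
    count-mono (reaches j') (reaches j) 0 n (λ i _ _ e → ≤⇒≤ᵇ≡true (≤-trans j≤j' (≤ᵇ≡true⇒≤ j' _ e)))

  ζ-zero : ζ n lam 0 ≡ n
  ζ-zero = count-all (reaches 0) 0 n (λ i _ _ → refl)

  1≤ζ : ∀ j → j ≤ lam 1 → 1 ≤ ζ n lam j
  1≤ζ j j≤ = ≤lam⇒≤ζ j 1 ≤-refl 1≤n j≤

  box : ∀ j i → 1 ≤ j → 1 ≤ i → i ≤ n → j ≤ lam i → Box n lam j i
  box j i 1≤j 1≤i i≤n j≤ = 1≤j , ≤-trans j≤ (lam≤lam₁ i 1≤i i≤n) , 1≤i , ≤lam⇒≤ζ j i 1≤i i≤n j≤

  box⇒≤n : ∀ {j i} → Box n lam j i → i ≤ n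
  box⇒≤n {j} (_ , _ , _ , i≤ζ) = ≤-trans i≤ζ (ζ≤n j)

  box⇒≤lam : ∀ {j i} → Box n lam j i → j ≤ lam i
  box⇒≤lam {j} {i} b@(_ , _ , 1≤i , i≤ζ) = ≤ζ⇒≤lam j i 1≤i (box⇒≤n b) i≤ζ

  box-in-column : ∀ {j i} i' → Box n lam j i → 1 ≤ i' → i' ≤ ζ n lam j → Box n lam j i'
  box-in-column i' (1≤j , j≤ , _ , _) 1≤i' i'≤ = 1≤j , j≤ , 1≤i' , i'≤

  module _ (T : ℕ → ℕ → ℕ) (tableau : Tableau n lam T) where

    column-spread : ∀ j i → Box n lam j i → ∀ k → i + k ≤ ζ n lam j → T j i + k ≤ T j (i + k)
    column-spread j i b zero _ rewrite +-identityʳ i | +-identityʳ (T j i) = ≤-refl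
    column-spread j i b@(_ , _ , 1≤i , _) (suc k) i+k<ζ rewrite +-suc (T j i) k | +-suc i k =
      ≤-trans (s≤s (column-spread j i b k i+k≤ζ))
              (proj₁ (proj₂ tableau) j (i + k) (box-in-column (i + k) b (≤-trans 1≤i (m≤m+n i k)) i+k≤ζ)
                                               (box-in-column (suc (i + k)) b (s≤s z≤n) i+k<ζ))
      where
      i+k≤ζ : i + k ≤ ζ n lam j
      i+k≤ζ = ≤-trans (n≤1+n _) i+k<ζ

    row-spread : ∀ j i → Box n lam j i → ∀ d → j + d ≤ lam i → T j i ≤ T (j + d) i
    row-spread j i b zero _ rewrite +-identityʳ j = ≤-refl
    row-spread j i b@(1≤j , _ , 1≤i , _) (suc d) j+d<lam rewrite +-suc j d =
      ≤-trans (row-spread j i b d j+d≤lam)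
              (proj₂ (proj₂ tableau) (j + d) i (box (j + d) i (≤-trans 1≤j (m≤m+n j d)) 1≤i i≤n j+d≤lam)
                                               (box (suc (j + d)) i (s≤s z≤n) 1≤i i≤n j+d<lam))
      where
      i≤n : i ≤ n
      i≤n = box⇒≤n b
      j+d≤lam : j + d ≤ lam i
      j+d≤lam = ≤-trans (n≤1+n _) j+d<lam

    row≤entry : ∀ j i → Box n lam j i → i ≤ T j i
    row≤entry j i b@(_ , _ , 1≤i , i≤ζ) = subst (_≤ T j i) (m+[n∸m]≡n 1≤i)
      (≤-trans (+-monoˡ-≤ (i ∸ 1) (proj₁ (proj₁ tableau j 1 top)))
               (subst (λ z → T j 1 + (i ∸ 1) ≤ T j z) (m+[n∸m]≡n 1≤i)
                      (column-spread j 1 top (i ∸ 1) (subst (_≤ ζ n lam j) (sym (m+[n∸m]≡n 1≤i)) i≤ζ))))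
      where
      top : Box n lam j 1
      top = box-in-column 1 b ≤-refl (≤-trans 1≤i i≤ζ)

  IsColumnLength : ℕ → Bool
  IsColumnLength k = anyᵇ (λ j → ζ n lam j ≡ᵇ k) (ioc 0 (lam 1))

  ζ-isColumnLength : ∀ j → 1 ≤ j → j ≤ lam 1 → IsColumnLength (ζ n lam j) ≡ true
  ζ-isColumnLength j 1≤j j≤ = ∃⇒anyᵇ-ioc _ 0 (lam 1) j 1≤j j≤ (≡ᵇ-refl (ζ n lam j))

  isColumnLength⇒descent : ∀ i → 1 ≤ i → suc i ≤ n → IsColumnLength i ≡ true → lam (suc i) < lam i
  isColumnLength⇒descent i 1≤i i<n e with anyᵇ-ioc⇒∃ _ 0 (lam 1) e
  ... | j , 1≤j , j≤ , ζj≡i with ≡ᵇ≡true⇒≡ (ζ n lam j) i ζj≡i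
  ... | refl with j ≤? lam (suc i)
  ...   | yes j≤ = ⊥-elim (<-irrefl refl (≤lam⇒≤ζ j (suc i) (s≤s z≤n) i<n j≤))
  ...   | no j≰ = <-≤-trans (≰⇒> j≰) (≤ζ⇒≤lam j (ζ n lam j) 1≤i (≤-trans (n≤1+n _) i<n) ≤-refl)

  descent⇒isColumnLength : ∀ i → 1 ≤ i → suc i ≤ n → lam (suc i) < lam i → IsColumnLength i ≡ true
  descent⇒isColumnLength i 1≤i i<n descent = subst (λ z → IsColumnLength z ≡ true) ζ[lamᵢ]≡i
      (ζ-isColumnLength (lam i) (≤-trans (s≤s z≤n) descent) (lam≤lam₁ i 1≤i (≤-trans (n≤1+n _) i<n)))
    where
    ζ[lamᵢ]≡i : ζ n lam (lam i) ≡ i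
    ζ[lamᵢ]≡i = ≤-antisym
      (≮⇒≥ λ i<ζ → <-irrefl refl (<-≤-trans descent (≤ζ⇒≤lam (lam i) (suc i) (s≤s z≤n) i<n i<ζ)))
      (≤lam⇒≤ζ (lam i) i 1≤i (≤-trans (n≤1+n _) i<n) ≤-refl)

module Carrels (n : ℕ) (1≤n : 1 ≤ n) (lam : ℕ → ℕ) (part : Partition n lam) where
  open Shape n 1≤n lam part

  private
    R : List ℕ
    R = Rlist n lam
    hits : HitsIn IsColumnLength 0 (n ∸ 1) R
    hits = filter-ioc-hits IsColumnLength 0 (n ∸ 1)

    ≤n∸1⇒<n : ∀ {x} → x ≤ n ∸ 1 → x < n
    ≤n∸1⇒<n {x} x≤ = subst (x <_) (trans (+-comm 1 (n ∸ 1)) (m∸n+n≡m 1≤n)) (s≤s x≤)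

  q-inner : ∀ h → suc h ≤ r n lam → q n lam (suc h) ≡ nth R h
  q-inner h h<r rewrite ≤⇒≤ᵇ≡true h<r = refl

  q-last : q n lam (suc (r n lam)) ≡ n
  q-last rewrite ≰⇒≤ᵇ≡false (suc (r n lam)) (r n lam) (<-irrefl refl) = refl

  q≡nth : ∀ h → h ≤ r n lam → q n lam h ≡ nth (0 ∷ R) h
  q≡nth zero _ = refl
  q≡nth (suc h) h<r = q-inner h h<r

  private
    hit : ∀ h → 1 ≤ h → h ≤ r n lam →
      q n lam (pred h) < q n lam h × q n lam h ≤ n ∸ 1 × IsColumnLength (q n lam h) ≡ true
      × NoneBetween IsColumnLength (q n lam (pred h)) (q n lam h)
    hit (suc h) _ h<r rewrite q-inner h h<r | q≡nth h (≤-trans (n≤1+n h) h<r) =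
      let (prev< , ≤n-1 , isLength , none) = proj₁ hits h h<r in prev< , ≤n-1 , isLength , none

  q-isColumnLength : ∀ h → 1 ≤ h → h ≤ r n lam → IsColumnLength (q n lam h) ≡ true
  q-isColumnLength h 1≤h h≤r = proj₁ (proj₂ (proj₂ (hit h 1≤h h≤r)))

  1≤q : ∀ h → 1 ≤ h → h ≤ r n lam → 1 ≤ q n lam h
  1≤q h 1≤h h≤r = ≤-trans (s≤s z≤n) (proj₁ (hit h 1≤h h≤r))

  q<n : ∀ h → h ≤ r n lam → q n lam h < n
  q<n zero _ = 1≤n
  q<n (suc h) h<r = ≤n∸1⇒<n (proj₁ (proj₂ (hit (suc h) (s≤s z≤n) h<r)))

  q≤n : ∀ h → h ≤ r n lam → q n lam (suc h) ≤ n
  q≤n h h≤r with m≤n⇒m<n∨m≡n h≤r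
  ... | inj₁ h<r = <⇒≤ (q<n (suc h) h<r)
  ... | inj₂ refl = ≤-reflexive q-last

  q<q : ∀ h → h ≤ r n lam → q n lam h < q n lam (suc h)
  q<q h h≤r with m≤n⇒m<n∨m≡n h≤r
  ... | inj₁ h<r = proj₁ (hit (suc h) (s≤s z≤n) h<r)
  ... | inj₂ refl rewrite q-last = q<n (r n lam) ≤-refl

  carrel-noColumnLength : ∀ h → h ≤ r n lam → NoneBetween IsColumnLength (q n lam h) (q n lam (suc h))
  carrel-noColumnLength h h≤r with m≤n⇒m<n∨m≡n h≤r
  ... | inj₁ h<r = proj₂ (proj₂ (proj₂ (hit (suc h) (s≤s z≤n) h<r)))
  ... | inj₂ refl rewrite q-last | q≡nth (r n lam) ≤-refl = λ k q<k k<n →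
    proj₂ hits k q<k (subst (k <_) (sym (trans (+-comm 1 (n ∸ 1)) (m∸n+n≡m 1≤n))) k<n)

  carrel-containing : ∀ k → 1 ≤ k → k ≤ n → ∃[ h ] (h ≤ r n lam × q n lam h < k × k ≤ q n lam (suc h))
  carrel-containing k 1≤k k≤n = crossing (q n lam) k (r n lam) 1≤k (subst (k ≤_) (sym q-last) k≤n)

  isColumnLength⇒q : ∀ k → 1 ≤ k → suc k ≤ n → IsColumnLength k ≡ true →
                     ∃[ h ] (1 ≤ h × h ≤ r n lam × q n lam h ≡ k)
  isColumnLength⇒q k 1≤k k<n isLength with carrel-containing k 1≤k (≤-trans (n≤1+n k) k<n)
  ... | h , h≤r , q<k , k≤q' with m≤n⇒m<n∨m≡n k≤q'
  ...   | inj₁ k<q' = ⊥-elim (false≢true (trans (sym (carrel-noColumnLength h h≤r k q<k k<q')) isLength))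
  ...   | inj₂ k≡q' with m≤n⇒m<n∨m≡n h≤r
  ...     | inj₁ h<r = suc h , s≤s z≤n , h<r , sym k≡q'
  ...     | inj₂ refl = ⊥-elim (<-irrefl (trans k≡q' q-last) k<n)

  lam-step-in-carrel : ∀ h → h ≤ r n lam → ∀ k → q n lam h < k → suc k ≤ q n lam (suc h) →
                       lam (suc k) ≡ lam k
  lam-step-in-carrel h h≤r k q<k k<q' = ≤-antisym (part k 1≤k k<n)
    (≮⇒≥ λ descent → false≢true (trans (sym (carrel-noColumnLength h h≤r k q<k k<q'))
                                       (descent⇒isColumnLength k 1≤k k<n descent)))
    where
    1≤k : 1 ≤ k
    1≤k = ≤-trans (s≤s z≤n) q<k
    k<n : suc k ≤ n
    k<n = ≤-trans k<q' (q≤n h h≤r)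

  lam-on-carrel : ∀ h → h ≤ r n lam → ∀ k → q n lam h < k → k ≤ q n lam (suc h) →
                  lam k ≡ lam (suc (q n lam h))
  lam-on-carrel h h≤r (suc k) q<k+1 k<q' with m≤n⇒m<n∨m≡n q<k+1
  ... | inj₂ refl = refl
  ... | inj₁ (s≤s q<k) =
    trans (lam-step-in-carrel h h≤r k q<k k<q') (lam-on-carrel h h≤r k q<k (≤-trans (n≤1+n k) k<q'))

  equal-lam⇒same-carrel : ∀ i → 1 ≤ i → suc i ≤ n → lam (suc i) ≡ lam i →
                          ∃[ h ] (h ≤ r n lam × q n lam h < i × suc i ≤ q n lam (suc h))
  equal-lam⇒same-carrel i 1≤i i<n lam≡ with carrel-containing i 1≤i (≤-trans (n≤1+n i) i<n)
  ... | h , h≤r , q<i , i≤q' with m≤n⇒m<n∨m≡n i≤q'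
  ...   | inj₁ i<q' = h , h≤r , q<i , i<q'
  ...   | inj₂ refl with m≤n⇒m<n∨m≡n h≤r
  ...     | inj₁ h<r = ⊥-elim (<-irrefl lam≡
                          (isColumnLength⇒descent i 1≤i i<n (q-isColumnLength (suc h) (s≤s z≤n) h<r)))
  ...     | inj₂ refl = ⊥-elim (<-irrefl q-last i<n)

  lam-drop-at-carrel : ∀ h → 1 ≤ h → h ≤ r n lam → suc (lam (q n lam (suc h))) ≤ lam (q n lam h)
  lam-drop-at-carrel h 1≤h h≤r =
    subst (λ z → suc z ≤ lam c) (sym (lam-on-carrel h h≤r (q n lam (suc h)) (q<q h h≤r) ≤-refl))
      (isColumnLength⇒descent c (1≤q h 1≤h h≤r) (q<n h h≤r) (q-isColumnLength h 1≤h h≤r))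
    where
    c : ℕ
    c = q n lam h

  ζ-past-carrel : ∀ h → 1 ≤ h → h ≤ r n lam → ζ n lam (suc (lam (q n lam (suc h)))) ≡ q n lam h
  ζ-past-carrel h 1≤h h≤r = ≤-antisym
    (≮⇒≥ λ c<ζ → <-irrefl refl
      (subst (λ z → suc j ≤ z) (sym (lam-on-carrel h h≤r (q n lam (suc h)) (q<q h h≤r) ≤-refl))
             (≤ζ⇒≤lam (suc j) (suc c) (s≤s z≤n) (q<n h h≤r) c<ζ)))
    (≤lam⇒≤ζ (suc j) c (1≤q h 1≤h h≤r) (<⇒≤ (q<n h h≤r)) (lam-drop-at-carrel h 1≤h h≤r))
    where
    c j : ℕ
    c = q n lam h
    j = lam (q n lam (suc h))

  ζ-at-carrel-end : ∀ h → h ≤ r n lam → 1 ≤ lam (q n lam (suc h)) →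
                    ζ n lam (lam (q n lam (suc h))) ≡ q n lam (suc h)
  ζ-at-carrel-end h h≤r 1≤j = ≤-antisym ζ≤c' (≤lam⇒≤ζ j c' 1≤c' (q≤n h h≤r) ≤-refl)
    where
    c' j : ℕ
    c' = q n lam (suc h)
    j = lam c'
    1≤c' : 1 ≤ c'
    1≤c' = ≤-trans (s≤s z≤n) (q<q h h≤r)
    ζ≤c' : ζ n lam j ≤ c'
    ζ≤c' with m≤n⇒m<n∨m≡n h≤r
    ... | inj₂ refl = subst (ζ n lam j ≤_) (sym q-last) (ζ≤n j)
    ... | inj₁ h<r = ≮⇒≥ λ c'<ζ → <-irrefl refl
          (<-≤-trans (isColumnLength⇒descent c' 1≤c' c'<n (q-isColumnLength (suc h) (s≤s z≤n) h<r))
                     (≤ζ⇒≤lam j (suc c') (s≤s z≤n) c'<n c'<ζ))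
      where
      c'<n : c' < n
      c'<n = q<n (suc h) h<r

  consecutive-column-lengths : ∀ j → 1 ≤ j → suc j ≤ lam 1 → ζ n lam (suc j) < ζ n lam j →
    ∃[ h ] (1 ≤ h × h ≤ r n lam × q n lam h ≡ ζ n lam (suc j) × q n lam (suc h) ≡ ζ n lam j)
  consecutive-column-lengths j 1≤j j<lam₁ c<c'
    with isColumnLength⇒q (ζ n lam (suc j)) (1≤ζ (suc j) j<lam₁) (≤-trans c<c' (ζ≤n j))
                          (ζ-isColumnLength (suc j) (s≤s z≤n) j<lam₁)
  ... | h , 1≤h , h≤r , q≡c = h , 1≤h , h≤r , q≡c , q'≡c'
    where
    c c' : ℕ
    c = ζ n lam (suc j)
    c' = ζ n lam j
    no-descent-between : ∀ k → c < k → suc k ≤ c' → lam (suc k) < lam k → ⊥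
    no-descent-between k c<k k<c' descent with suc j ≤? lam k
    ... | yes j<lamₖ = <-irrefl refl (≤-trans c<k
          (≤lam⇒≤ζ (suc j) k (≤-trans (s≤s z≤n) c<k) (≤-trans (n≤1+n k) (≤-trans k<c' (ζ≤n j))) j<lamₖ))
    ... | no j≮lamₖ = <-irrefl refl (<-≤-trans descent
          (≤-trans (≤-pred (≰⇒> j≮lamₖ)) (≤ζ⇒≤lam j (suc k) (s≤s z≤n) (≤-trans k<c' (ζ≤n j)) k<c')))
    q'≡c' : q n lam (suc h) ≡ c'
    q'≡c' with <-cmp (q n lam (suc h)) c'
    ... | tri≈ _ q'≡c' _ = q'≡c'
    ... | tri< q'<c' _ _ with m≤n⇒m<n∨m≡n h≤r
    ...   | inj₂ refl = ⊥-elim (<-irrefl refl (<-≤-trans q'<c' (subst (c' ≤_) (sym q-last) (ζ≤n j))))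
    ...   | inj₁ h<r = ⊥-elim (no-descent-between (q n lam (suc h)) (subst (_< q n lam (suc h)) q≡c (q<q h h≤r)) q'<c'
                               (isColumnLength⇒descent _ (1≤q (suc h) (s≤s z≤n) h<r) (q<n (suc h) h<r)
                                  (q-isColumnLength (suc h) (s≤s z≤n) h<r)))
    q'≡c' | tri> _ _ c'<q' = ⊥-elim (false≢true (trans
            (sym (carrel-noColumnLength h h≤r c' (subst (_< c') (sym q≡c) c<c') c'<q'))
            (ζ-isColumnLength j 1≤j (≤-trans (n≤1+n j) j<lam₁))))

slack : (ℕ → ℕ) → ℕ → ℕ
slack γ k = γ k ∸ k

IncreasingOn : (ℕ → ℕ) → ℕ → ℕ → Set
IncreasingOn γ i i' = ∀ k → i ≤ k → suc k ≤ i' → γ k < γ (suc k)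

slack-monotone : ∀ γ i i' → i ≤ i' → IncreasingOn γ i i' → slack γ i ≤ slack γ i'
slack-monotone γ i i' i≤i' incr = subst (λ z → slack γ i ≤ slack γ z) (m+[n∸m]≡n i≤i')
  (go (i' ∸ i) (≤-reflexive (m+[n∸m]≡n i≤i')))
  where
  go : ∀ d → i + d ≤ i' → slack γ i ≤ slack γ (i + d)
  go zero _ rewrite +-identityʳ i = ≤-refl
  go (suc d) i+d<i' rewrite +-suc i d =
    ≤-trans (go d (≤-trans (n≤1+n _) i+d<i')) (∸-monoˡ-≤ (suc (i + d)) (incr (i + d) (m≤m+n i d) i+d<i'))

rangeMin-slack-increasing : ∀ γ i l → IncreasingOn γ i (i + l) → rangeMin (slack γ) i l ≡ slack γ i
rangeMin-slack-increasing γ i l incr = rangeMin-head (slack γ) i l λ k k≤l →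
  slack-monotone γ i (i + k) (m≤m+n i k) (λ m i≤m m<i+k → incr m i≤m (≤-trans m<i+k (+-monoʳ-≤ i k≤l)))

least-in-range : (P : ℕ → Set) → (∀ i → Dec (P i)) → ∀ c →
  (∃[ a ] (1 ≤ a × a ≤ c × P a × (∀ i → 1 ≤ i → i < a → ¬ P i))) ⊎ (∀ i → 1 ≤ i → i ≤ c → ¬ P i)
least-in-range P P? zero = inj₂ (λ i 1≤i i≤0 _ → <-irrefl refl (≤-trans 1≤i i≤0))
least-in-range P P? (suc c) with least-in-range P P? c
... | inj₁ (a , 1≤a , a≤c , Pa , below) = inj₁ (a , 1≤a , m≤n⇒m≤1+n a≤c , Pa , below)
... | inj₂ none with P? (suc c)
...   | yes Pc+1 = inj₁ (suc c , s≤s z≤n , ≤-refl , Pc+1 , λ i 1≤i i≤c → none i 1≤i (≤-pred i≤c))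
...   | no ¬Pc+1 = inj₂ none'
  where
  none' : ∀ i → 1 ≤ i → i ≤ suc c → ¬ P i
  none' i 1≤i i≤c+1 with m≤n⇒m<n∨m≡n i≤c+1
  ... | inj₁ (s≤s i≤c) = none i 1≤i i≤c
  ... | inj₂ refl = ¬Pc+1

module MaximalTableau (n : ℕ) (1≤n : 1 ≤ n) (lam : ℕ → ℕ) (part : Partition n lam)
                      (γ : ℕ → ℕ) (gapless : Gapless n lam γ) where
  open Shape n 1≤n lam part
  open Carrels n 1≤n lam part

  k≤γ : ∀ k → 1 ≤ k → k ≤ n → k ≤ γ k
  k≤γ k 1≤k k≤n = proj₁ (proj₁ gapless k 1≤k k≤n)

  γ≤n : ∀ k → 1 ≤ k → k ≤ n → γ k ≤ n
  γ≤n k 1≤k k≤n = proj₂ (proj₁ gapless k 1≤k k≤n)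

  γ≡k+slack : ∀ k → 1 ≤ k → k ≤ n → γ k ≡ k + slack γ k
  γ≡k+slack k 1≤k k≤n = sym (m+[n∸m]≡n (k≤γ k 1≤k k≤n))

  γ-increasing-in-carrel : ∀ h → h ≤ r n lam → IncreasingOn γ (suc (q n lam h)) (q n lam (suc h))
  γ-increasing-in-carrel h h≤r k q<k = proj₁ (proj₂ gapless) h h≤r k q<k

  γ-increasing-at-equal-lam : ∀ i → 1 ≤ i → suc i ≤ n → lam (suc i) ≡ lam i → γ i < γ (suc i)
  γ-increasing-at-equal-lam i 1≤i i<n lam≡ =
    let (h , h≤r , q<i , i<q') = equal-lam⇒same-carrel i 1≤i i<n lam≡ in
    γ-increasing-in-carrel h h≤r i q<i i<q'

  -- The entry in row i of any column of M_λ(γ) of length c.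
  maxEntry : ℕ → ℕ → ℕ
  maxEntry c i = i + rangeMin (slack γ) i (c ∸ i)

  maxEntry≤γ : ∀ c i → i ≤ c → 1 ≤ c → c ≤ n → maxEntry c i ≤ γ c
  maxEntry≤γ c i i≤c 1≤c c≤n = begin
    i + rangeMin (slack γ) i (c ∸ i) ≤⟨ +-monoʳ-≤ i (rangeMin-≤ (slack γ) i (c ∸ i) (c ∸ i) ≤-refl) ⟩
    i + slack γ (i + (c ∸ i))        ≡⟨ cong (λ z → i + slack γ z) (m+[n∸m]≡n i≤c) ⟩
    i + slack γ c                    ≤⟨ +-monoˡ-≤ (slack γ c) i≤c ⟩
    c + slack γ c                    ≡⟨ sym (γ≡k+slack c 1≤c c≤n) ⟩
    γ c                              ∎
    where open ≤-Reasoning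

  maxEntry-last : ∀ c → 1 ≤ c → c ≤ n → maxEntry c c ≡ γ c
  maxEntry-last c 1≤c c≤n rewrite n∸n≡0 c = sym (γ≡k+slack c 1≤c c≤n)

  maxEntry-increasing : ∀ c i → suc i ≤ c → maxEntry c i < maxEntry c (suc i)
  maxEntry-increasing (suc c) i (s≤s i≤c) rewrite +-∸-assoc 1 i≤c =
    s≤s (+-monoʳ-≤ i (m⊓n≤n (slack γ i) (rangeMin (slack γ) (suc i) (c ∸ i))))

  Mmax : ℕ → ℕ → ℕ
  Mmax j i = maxEntry (ζ n lam j) i

  Mmax-at-lam : ∀ i → 1 ≤ i → i ≤ n → 1 ≤ lam i → Mmax (lam i) i ≡ γ i
  Mmax-at-lam i 1≤i i≤n _ = begin
    i + rangeMin (slack γ) i (c ∸ i) ≡⟨ cong (i +_) (rangeMin-slack-increasing γ i (c ∸ i) increasing) ⟩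
    i + slack γ i                    ≡⟨ sym (γ≡k+slack i 1≤i i≤n) ⟩
    γ i                              ∎
    where
    open ≡-Reasoning
    c : ℕ
    c = ζ n lam (lam i)
    i+[c∸i]≡c : i + (c ∸ i) ≡ c
    i+[c∸i]≡c = m+[n∸m]≡n (≤lam⇒≤ζ (lam i) i 1≤i i≤n ≤-refl)
    increasing : IncreasingOn γ i (i + (c ∸ i))
    increasing k i≤k k<c' = γ-increasing-at-equal-lam k 1≤k k<n (≤-antisym
        (part k 1≤k k<n)
        (≤-trans (lam-antitone i k 1≤i i≤k (≤-trans (n≤1+n k) k<n)) (≤ζ⇒≤lam (lam i) (suc k) (s≤s z≤n) k<n k<c)))
      where
      k<c : suc k ≤ c
      k<c = subst (suc k ≤_) i+[c∸i]≡c k<c'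
      k<n : suc k ≤ n
      k<n = ≤-trans k<c (ζ≤n (lam i))
      1≤k : 1 ≤ k
      1≤k = ≤-trans 1≤i i≤k

  Mmax-tableau : Tableau n lam Mmax
  Mmax-tableau = bounded , column-increasing , row-nondecreasing
    where
    bounded : ∀ j i → Box n lam j i → (1 ≤ Mmax j i) × (Mmax j i ≤ n)
    bounded j i (_ , _ , 1≤i , i≤ζ) =
      ≤-trans 1≤i (m≤m+n i _) ,
      ≤-trans (maxEntry≤γ (ζ n lam j) i i≤ζ 1≤ζ' (ζ≤n j)) (γ≤n _ 1≤ζ' (ζ≤n j))
      where
      1≤ζ' : 1 ≤ ζ n lam j
      1≤ζ' = ≤-trans 1≤i i≤ζ
    column-increasing : ∀ j i → Box n lam j i → Box n lam j (suc i) → Mmax j i < Mmax j (suc i)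
    column-increasing j i _ (_ , _ , _ , i<ζ) = maxEntry-increasing (ζ n lam j) i i<ζ
    row-nondecreasing : ∀ j i → Box n lam j i → Box n lam (suc j) i → Mmax j i ≤ Mmax (suc j) i
    row-nondecreasing j i _ _ = +-monoʳ-≤ i
      (rangeMin-antitone (slack γ) i _ _ (∸-monoˡ-≤ i (ζ-antitone j (suc j) (n≤1+n j))))

  Mmax-fits : Fits n lam γ Mmax
  Mmax-fits = Mmax-tableau , Mmax-at-lam

  module _ (T : ℕ → ℕ → ℕ) (fits : Fits n lam γ T) where
    entry≤γ : ∀ j i → Box n lam j i → T j i ≤ γ i
    entry≤γ j i b@(1≤j , _ , 1≤i , _) = subst (T j i ≤_) T[lam]≡γ
      (row-spread T (proj₁ fits) j i b (lam i ∸ j) (≤-reflexive (m+[n∸m]≡n j≤lam)))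
      where
      j≤lam : j ≤ lam i
      j≤lam = box⇒≤lam b
      T[lam]≡γ : T (j + (lam i ∸ j)) i ≡ γ i
      T[lam]≡γ = trans (cong (λ z → T z i) (m+[n∸m]≡n j≤lam))
                       (proj₂ fits i 1≤i (box⇒≤n b) (≤-trans 1≤j j≤lam))

    fits⇒≤Mmax : T ≤T[ n , lam ] Mmax
    fits⇒≤Mmax j i b@(_ , _ , 1≤i , i≤ζ) = subst (_≤ Mmax j i) (m+[n∸m]≡n (row≤entry T (proj₁ fits) j i b))
      (+-monoʳ-≤ i (rangeMin-greatest (slack γ) i (ζ n lam j ∸ i) (T j i ∸ i) below-slack))
      where
      below-slack : ∀ k → k ≤ ζ n lam j ∸ i → T j i ∸ i ≤ slack γ (i + k)
      below-slack k k≤ = m+n≤o⇒m≤o∸n (T j i ∸ i) (subst (_≤ γ (i + k)) rearrange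
          (≤-trans (column-spread T (proj₁ fits) j i b k i+k≤ζ)
                   (entry≤γ j (i + k) (box-in-column (i + k) b (≤-trans 1≤i (m≤m+n i k)) i+k≤ζ))))
        where
        i+k≤ζ : i + k ≤ ζ n lam j
        i+k≤ζ = subst (i + k ≤_) (m+[n∸m]≡n i≤ζ) (+-monoʳ-≤ i k≤)
        rearrange : T j i + k ≡ T j i ∸ i + (i + k)
        rearrange = trans (cong (_+ k) (sym (m∸n+n≡m (row≤entry T (proj₁ fits) j i b)))) (+-assoc (T j i ∸ i) i k)

  isMλ⇒≡Mmax : ∀ M → IsMλ n lam γ M → ∀ j i → Box n lam j i → M j i ≡ Mmax j i
  isMλ⇒≡Mmax M (M-fits , M-max) j i b = ≤-antisym (fits⇒≤Mmax M M-fits j i b) (M-max Mmax Mmax-fits j i b)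

  InColumn : ℕ → ℕ → Set
  InColumn c x = ∃[ i ] (1 ≤ i × i ≤ c × maxEntry c i ≡ x)

  ColumnStep : ℕ → ℕ → Set
  ColumnStep c c' = ∃[ e ] (∀ x → x ≤ γ c → InColumn c' x ⇔ ((InColumn c x × x < e) ⊎ e ≤ x))

  DropCondition : ℕ → ℕ → Set
  DropCondition c c' = γ (suc c) < γ c →
    let s = γ c ∸ γ (suc c) + 1 in
    (s ≤ c' ∸ c) × (∀ t → 1 ≤ t → t ≤ s → γ (c + t) ≡ (γ c ∸ s) + t)

  module ConsecutiveLengths (c c' : ℕ) (1≤c : 1 ≤ c) (c<c' : c < c') (c'≤n : c' ≤ n)
                         (increasing : IncreasingOn γ (suc c) c') (drop : DropCondition c c') where

    c≤n : c ≤ n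
    c≤n = ≤-trans (n≤1+n c) (≤-trans c<c' c'≤n)

    μ : ℕ
    μ = slack γ (suc c)

    μ≤slack : ∀ k → c < k → k ≤ c' → μ ≤ slack γ k
    μ≤slack k c<k k≤c' = slack-monotone γ (suc c) k c<k (λ m c<m m<k → increasing m c<m (≤-trans m<k k≤c'))

    new-row : ∀ k → c < k → k ≤ c' → maxEntry c' k ≡ γ k
    new-row k c<k k≤c' = begin
      k + rangeMin (slack γ) k (c' ∸ k) ≡⟨ cong (k +_) (rangeMin-slack-increasing γ k (c' ∸ k) increasing-from-k) ⟩
      k + slack γ k                      ≡⟨ sym (γ≡k+slack k (≤-trans (s≤s z≤n) c<k) (≤-trans k≤c' c'≤n)) ⟩
      γ k                                ∎
      where
      open ≡-Reasoning
      increasing-from-k : IncreasingOn γ k (k + (c' ∸ k))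
      increasing-from-k m k≤m m<c' =
        increasing m (≤-trans c<k k≤m) (subst (suc m ≤_) (m+[n∸m]≡n k≤c') m<c')

    new-row-≥ : ∀ k → c < k → k ≤ c' → k + μ ≤ maxEntry c' k
    new-row-≥ k c<k k≤c' = subst (k + μ ≤_) (trans (sym (γ≡k+slack k (≤-trans (s≤s z≤n) c<k) (≤-trans k≤c' c'≤n)))
                                                   (sym (new-row k c<k k≤c')))
                             (+-monoʳ-≤ k (μ≤slack k c<k k≤c'))

    oldMin : ℕ → ℕ
    oldMin i = rangeMin (slack γ) i (c ∸ i)

    old-row : ∀ i → i ≤ c → maxEntry c' i ≡ i + (oldMin i ⊓ μ)
    old-row i i≤c = cong (i +_) (begin
      rangeMin (slack γ) i (c' ∸ i)
        ≡⟨ cong (rangeMin (slack γ) i) c'∸i≡ ⟩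
      rangeMin (slack γ) i ((c ∸ i) + suc Y)
        ≡⟨ rangeMin-split (slack γ) i (c ∸ i) Y ⟩
      oldMin i ⊓ rangeMin (slack γ) (i + suc (c ∸ i)) Y
        ≡⟨ cong (λ z → oldMin i ⊓ rangeMin (slack γ) z Y) i+[c∸i+1]≡ ⟩
      oldMin i ⊓ rangeMin (slack γ) (suc c) Y
        ≡⟨ cong (oldMin i ⊓_) tail≡μ ⟩
      oldMin i ⊓ μ
        ∎)
      where
      open ≡-Reasoning
      Y : ℕ
      Y = c' ∸ suc c
      i+[c∸i+1]≡ : i + suc (c ∸ i) ≡ suc c
      i+[c∸i+1]≡ = trans (+-suc i (c ∸ i)) (cong suc (m+[n∸m]≡n i≤c))
      c'∸i≡ : c' ∸ i ≡ (c ∸ i) + suc Y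
      c'∸i≡ = begin
        c' ∸ i                          ≡⟨ cong (_∸ i) (sym (m+[n∸m]≡n c<c')) ⟩
        (suc c + Y) ∸ i                 ≡⟨ cong (λ z → (z + Y) ∸ i) (sym i+[c∸i+1]≡) ⟩
        (i + suc (c ∸ i) + Y) ∸ i       ≡⟨ cong (_∸ i) (+-assoc i (suc (c ∸ i)) Y) ⟩
        (i + (suc (c ∸ i) + Y)) ∸ i     ≡⟨ m+n∸m≡n i _ ⟩
        suc (c ∸ i) + Y                 ≡⟨ sym (+-suc (c ∸ i) Y) ⟩
        (c ∸ i) + suc Y                 ∎
      tail≡μ : rangeMin (slack γ) (suc c) Y ≡ μ
      tail≡μ = rangeMin-slack-increasing γ (suc c) Y
        (λ m c<m m<c' → increasing m c<m (subst (suc m ≤_) (m+[n∸m]≡n c<c') m<c'))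

    oldMin≤slack : ∀ i → i ≤ c → oldMin i ≤ slack γ c
    oldMin≤slack i i≤c = subst (λ z → oldMin i ≤ slack γ z) (m+[n∸m]≡n i≤c)
                           (rangeMin-≤ (slack γ) i (c ∸ i) (c ∸ i) ≤-refl)

    oldMin-last : oldMin c ≡ slack γ c
    oldMin-last rewrite n∸n≡0 c = refl

    oldMin-monotone : ∀ i i' → i ≤ i' → i' ≤ c → oldMin i ≤ oldMin i'
    oldMin-monotone i i' i≤i' i'≤c = rangeMin-greatest (slack γ) i' (c ∸ i') (oldMin i) λ k k≤ →
        subst (oldMin i ≤_) (cong (slack γ) (shift k)) (rangeMin-≤ (slack γ) i (c ∸ i) ((i' ∸ i) + k) (within k k≤))
      where
      shift : ∀ k → i + ((i' ∸ i) + k) ≡ i' + k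
      shift k = trans (sym (+-assoc i (i' ∸ i) k)) (cong (_+ k) (m+[n∸m]≡n i≤i'))
      within : ∀ k → k ≤ c ∸ i' → (i' ∸ i) + k ≤ c ∸ i
      within k k≤ = m+n≤o⇒m≤o∸n _ (subst (_≤ c) (trans (sym (shift k)) (+-comm i _))
                      (subst (i' + k ≤_) (m+[n∸m]≡n i'≤c) (+-monoʳ-≤ i' k≤)))

    step-unchanged : slack γ c ≤ μ → ColumnStep c c'
    step-unchanged slack≤μ = suc (γ c) , λ x x≤γ → mk⇔ (to x x≤γ) (from x x≤γ)
      where
      same : ∀ i → i ≤ c → maxEntry c' i ≡ maxEntry c i
      same i i≤c = trans (old-row i i≤c) (cong (i +_) (m≤n⇒m⊓n≡m (≤-trans (oldMin≤slack i i≤c) slack≤μ)))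
      to : ∀ x → x ≤ γ c → InColumn c' x → (InColumn c x × x < suc (γ c)) ⊎ suc (γ c) ≤ x
      to x x≤γ (i , 1≤i , i≤c' , entry≡x) with i ≤? c
      ... | yes i≤c = inj₁ ((i , 1≤i , i≤c , trans (sym (same i i≤c)) entry≡x) , s≤s x≤γ)
      ... | no i≰c = ⊥-elim (<-irrefl refl (≤-trans (s≤s x≤γ) (subst (suc (γ c) ≤_) entry≡x above)))
        where
        c<i : c < i
        c<i = ≰⇒> i≰c
        above : suc (γ c) ≤ maxEntry c' i
        above = ≤-trans (subst (_≤ suc c + μ) (sym (cong suc (γ≡k+slack c 1≤c c≤n))) (+-monoʳ-≤ (suc c) slack≤μ))
                        (≤-trans (+-monoˡ-≤ μ c<i) (new-row-≥ i c<i i≤c'))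
      from : ∀ x → x ≤ γ c → (InColumn c x × x < suc (γ c)) ⊎ suc (γ c) ≤ x → InColumn c' x
      from x _ (inj₁ ((i , 1≤i , i≤c , entry≡x) , _)) =
        i , 1≤i , ≤-trans i≤c (<⇒≤ c<c') , trans (same i i≤c) entry≡x
      from x x≤γ (inj₂ γ<x) = ⊥-elim (<-irrefl refl (≤-trans γ<x x≤γ))

    module Lowered (μ<slack : μ < slack γ c) where

      s : ℕ
      s = slack γ c ∸ μ

      γc≡ : γ c ≡ (c + μ) + s
      γc≡ = trans (γ≡k+slack c 1≤c c≤n)
                  (trans (cong (c +_) (sym (m+[n∸m]≡n (<⇒≤ μ<slack)))) (sym (+-assoc c μ s)))

      γ[c+1]≡ : γ (suc c) ≡ suc (c + μ)
      γ[c+1]≡ = γ≡k+slack (suc c) (s≤s z≤n) (≤-trans c<c' c'≤n)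

      1≤s : 1 ≤ s
      1≤s = m+n≤o⇒m≤o∸n 1 μ<slack

      γc-drops : 2 ≤ s → γ (suc c) < γ c
      γc-drops 2≤s = subst₂ _<_ (sym γ[c+1]≡) (sym γc≡)
        (subst (_< (c + μ) + s) (+-comm (c + μ) 1) (+-monoʳ-< (c + μ) 2≤s))

      drop-length : γ c ∸ γ (suc c) + 1 ≡ s
      drop-length = begin
        γ c ∸ γ (suc c) + 1                ≡⟨ cong₂ (λ u v → u ∸ v + 1) γc≡ γ[c+1]≡ ⟩
        (c + μ) + s ∸ suc (c + μ) + 1      ≡⟨ cong (λ z → (c + μ) + s ∸ z + 1) (+-comm 1 (c + μ)) ⟩
        (c + μ) + s ∸ (c + μ + 1) + 1      ≡⟨ cong (_+ 1) (∸-+-assoc ((c + μ) + s) (c + μ) 1) ⟨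
        (c + μ) + s ∸ (c + μ) ∸ 1 + 1      ≡⟨ cong (λ z → z ∸ 1 + 1) (m+n∸m≡n (c + μ) s) ⟩
        s ∸ 1 + 1                          ≡⟨ m∸n+n≡m 1≤s ⟩
        s                                  ∎
        where open ≡-Reasoning

      -- The gapless condition at q_h fills the rows c+1, …, c+s with the values c+μ+1, …, c+μ+s.
      tail-row : ∀ t → 1 ≤ t → t ≤ s → c + t ≤ c' × maxEntry c' (c + t) ≡ (c + μ) + t
      tail-row (suc zero) _ _ = c+1≤c' , trans (new-row (c + 1) (m<m+n c (s≤s z≤n)) c+1≤c')
                                              (trans (cong γ (+-comm c 1)) (trans γ[c+1]≡ (sym (+-comm (c + μ) 1))))
        where
        c+1≤c' : c + 1 ≤ c'
        c+1≤c' = subst (_≤ c') (+-comm 1 c) c<c'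
      tail-row t@(suc (suc _)) 1≤t t≤s with drop (γc-drops (≤-trans (s≤s (s≤s z≤n)) t≤s))
      ... | length≤gap , values rewrite drop-length =
        c+t≤c' , trans (new-row (c + t) (m<m+n c 1≤t) c+t≤c') (trans (values t 1≤t t≤s) γ-tail)
        where
        c+t≤c' : c + t ≤ c'
        c+t≤c' = subst (c + t ≤_) (m+[n∸m]≡n (<⇒≤ c<c')) (+-monoʳ-≤ c (≤-trans t≤s length≤gap))
        γ-tail : (γ c ∸ s) + t ≡ (c + μ) + t
        γ-tail = cong (_+ t) (trans (cong (_∸ s) γc≡) (m+n∸n≡m (c + μ) s))

      private
        first-lowered : ∃[ a ] (1 ≤ a × a ≤ c × μ < oldMin a × (∀ i → 1 ≤ i → i < a → ¬ (μ < oldMin i)))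
        first-lowered with least-in-range (λ i → μ < oldMin i) (λ i → μ <? oldMin i) c
        ... | inj₁ found = found
        ... | inj₂ none = ⊥-elim (none c 1≤c ≤-refl (subst (μ <_) (sym oldMin-last) μ<slack))

      a : ℕ
      a = proj₁ first-lowered

      1≤a : 1 ≤ a
      1≤a = proj₁ (proj₂ first-lowered)

      a≤c : a ≤ c
      a≤c = proj₁ (proj₂ (proj₂ first-lowered))

      μ<oldMin : ∀ i → a ≤ i → i ≤ c → μ < oldMin i
      μ<oldMin i a≤i i≤c = <-≤-trans (proj₁ (proj₂ (proj₂ (proj₂ first-lowered)))) (oldMin-monotone a i a≤i i≤c)

      oldMin≤μ : ∀ i → 1 ≤ i → i < a → oldMin i ≤ μ
      oldMin≤μ i 1≤i i<a = ≮⇒≥ (proj₂ (proj₂ (proj₂ (proj₂ first-lowered))) i 1≤i i<a)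

      row-lowered : ∀ i → a ≤ i → i ≤ c → maxEntry c' i ≡ i + μ
      row-lowered i a≤i i≤c = trans (old-row i i≤c) (cong (i +_) (m≥n⇒m⊓n≡n (<⇒≤ (μ<oldMin i a≤i i≤c))))

      row-kept : ∀ i → 1 ≤ i → i < a → maxEntry c' i ≡ maxEntry c i
      row-kept i 1≤i i<a = trans (old-row i i≤c) (cong (i +_) (m≤n⇒m⊓n≡m (oldMin≤μ i 1≤i i<a)))
        where
        i≤c : i ≤ c
        i≤c = ≤-trans (<⇒≤ i<a) a≤c

      to : ∀ x → InColumn c' x → (InColumn c x × x < a + μ) ⊎ a + μ ≤ x
      to x (i , 1≤i , i≤c' , entry≡x) with i ≤? c
      ... | no i≰c = inj₂ (subst (a + μ ≤_) entry≡x
                      (≤-trans (+-monoˡ-≤ μ (≤-trans a≤c (<⇒≤ (≰⇒> i≰c)))) (new-row-≥ i (≰⇒> i≰c) i≤c')))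
      ... | yes i≤c with a ≤? i
      ...   | yes a≤i = inj₂ (subst (a + μ ≤_) (trans (sym (row-lowered i a≤i i≤c)) entry≡x) (+-monoˡ-≤ μ a≤i))
      ...   | no a≰i = inj₁ ((i , 1≤i , i≤c , trans (sym (row-kept i 1≤i (≰⇒> a≰i))) entry≡x) ,
                             subst (_< a + μ) (trans (sym (old-row i i≤c)) entry≡x)
                                   (+-mono-<-≤ (≰⇒> a≰i) (m⊓n≤n (oldMin i) μ)))

      from-kept : ∀ x → InColumn c x → x < a + μ → InColumn c' x
      from-kept x (i , 1≤i , i≤c , entry≡x) x<a+μ with a ≤? i
      ... | yes a≤i = ⊥-elim (<-irrefl refl (≤-trans x<a+μ (subst (a + μ ≤_) entry≡x
                        (+-mono-≤ a≤i (<⇒≤ (μ<oldMin i a≤i i≤c))))))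
      ... | no a≰i = i , 1≤i , ≤-trans i≤c (<⇒≤ c<c') , trans (row-kept i 1≤i (≰⇒> a≰i)) entry≡x

      from-high : ∀ x → x ≤ γ c → a + μ ≤ x → InColumn c' x
      from-high x x≤γ a+μ≤x = from-high′ (m∸n+n≡m (≤-trans (m≤n+m μ a) a+μ≤x))
        where
        from-high′ : x ∸ μ + μ ≡ x → InColumn c' x
        from-high′ x∸μ+μ≡x with x ∸ μ ≤? c
        ... | yes i≤c = x ∸ μ , ≤-trans 1≤a a≤i , ≤-trans i≤c (<⇒≤ c<c') ,
                        trans (row-lowered (x ∸ μ) a≤i i≤c) x∸μ+μ≡x
          where
          a≤i : a ≤ x ∸ μ
          a≤i = m+n≤o⇒m≤o∸n a a+μ≤x
        ... | no i≰c = c + t , ≤-trans 1≤t (m≤n+m t c) , proj₁ (tail-row t 1≤t t≤s) ,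
                       trans (proj₂ (tail-row t 1≤t t≤s)) (trans c+μ+t≡ x∸μ+μ≡x)
          where
          c<i : c < x ∸ μ
          c<i = ≰⇒> i≰c
          t : ℕ
          t = x ∸ μ ∸ c
          1≤t : 1 ≤ t
          1≤t = m+n≤o⇒m≤o∸n 1 c<i
          c+t≡i : c + t ≡ x ∸ μ
          c+t≡i = m+[n∸m]≡n (<⇒≤ c<i)
          t≤s : t ≤ s
          t≤s = +-cancelˡ-≤ c t s (+-cancelʳ-≤ μ (c + t) (c + s) (begin
            (c + t) + μ ≡⟨ cong (_+ μ) c+t≡i ⟩
            x ∸ μ + μ   ≡⟨ x∸μ+μ≡x ⟩
            x           ≤⟨ x≤γ ⟩
            γ c         ≡⟨ γc≡ ⟩
            (c + μ) + s ≡⟨ xy∙z≈xz∙y c μ s ⟩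
            (c + s) + μ ∎))
            where open ≤-Reasoning
          c+μ+t≡ : (c + μ) + t ≡ x ∸ μ + μ
          c+μ+t≡ = trans (xy∙z≈xz∙y c μ t) (cong (_+ μ) c+t≡i)

      step-lowered : ColumnStep c c'
      step-lowered = a + μ , λ x x≤γ → mk⇔ (to x) λ where
        (inj₁ (in-c , x<a+μ)) → from-kept x in-c x<a+μ
        (inj₂ a+μ≤x) → from-high x x≤γ a+μ≤x

    column-step : ColumnStep c c'
    column-step with slack γ c ≤? μ
    ... | yes slack≤μ = step-unchanged slack≤μ
    ... | no slack≰μ = Lowered.step-lowered (≰⇒> slack≰μ)

  column-step-at-carrel : ∀ h → 1 ≤ h → h ≤ r n lam → ColumnStep (q n lam h) (q n lam (suc h))
  column-step-at-carrel h 1≤h h≤r =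
    ConsecutiveLengths.column-step (q n lam h) (q n lam (suc h)) (1≤q h 1≤h h≤r) (q<q h h≤r) (q≤n h h≤r)
      (γ-increasing-in-carrel h h≤r) (proj₂ (proj₂ gapless) h 1≤h h≤r)

module KeyOfMaximum (n : ℕ) (1≤n : 1 ≤ n) (lam : ℕ → ℕ) (part : Partition n lam)
                    (γ : ℕ → ℕ) (gapless : Gapless n lam γ) (M : ℕ → ℕ → ℕ) (isM : IsMλ n lam γ M) where
  open Shape n 1≤n lam part
  open Carrels n 1≤n lam part
  open MaximalTableau n 1≤n lam part γ gapless

  M≡Mmax : ∀ j i → Box n lam j i → M j i ≡ Mmax j i
  M≡Mmax = isMλ⇒≡Mmax M isM

  inB⇒inColumn : ∀ j → 1 ≤ j → j ≤ lam 1 → ∀ x → inB n lam M j x ≡ true → InColumn (ζ n lam j) x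
  inB⇒inColumn (suc j) 1≤j j≤ x x∈ =
    let (i , 1≤i , i≤ζ , M≡x) = anyᵇ-ioc⇒∃ _ 0 _ x∈ in
    i , 1≤i , i≤ζ , trans (sym (M≡Mmax (suc j) i (1≤j , j≤ , 1≤i , i≤ζ))) (≡ᵇ≡true⇒≡ _ _ M≡x)

  inColumn⇒inB : ∀ j → 1 ≤ j → j ≤ lam 1 → ∀ x → InColumn (ζ n lam j) x → inB n lam M j x ≡ true
  inColumn⇒inB (suc j) 1≤j j≤ x (i , 1≤i , i≤ζ , Mmax≡x) =
    ∃⇒anyᵇ-ioc _ 0 _ i 1≤i i≤ζ
      (subst (λ z → (z ≡ᵇ x) ≡ true) (sym (trans (M≡Mmax (suc j) i (1≤j , j≤ , 1≤i , i≤ζ)) Mmax≡x))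
             (≡ᵇ-refl x))

  inB-latent : ∀ x → 1 ≤ x → x ≤ n → inB n lam M 0 x ≡ true
  inB-latent x 1≤x x≤n = ∃⇒anyᵇ-ioc _ 0 _ x 1≤x (subst (x ≤_) (sym ζ-zero) x≤n) (≡ᵇ-refl x)

  column-inclusion-step : ∀ j → 1 ≤ j → suc j ≤ lam 1 → ∀ x →
                          InColumn (ζ n lam (suc j)) x → InColumn (ζ n lam j) x
  column-inclusion-step j 1≤j j<lam₁ x x∈ with m≤n⇒m<n∨m≡n (ζ-antitone j (suc j) (n≤1+n j))
  ... | inj₂ ζ≡ = subst (λ z → InColumn z x) ζ≡ x∈
  ... | inj₁ ζ< with consecutive-column-lengths j 1≤j j<lam₁ ζ<
  ...   | h , 1≤h , h≤r , q≡c , q'≡c' with column-step-at-carrel h 1≤h h≤r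
  ...     | e , step rewrite q≡c | q'≡c' = Equivalence.from (step x x≤γ) below-or-above
    where
    c : ℕ
    c = ζ n lam (suc j)
    x≤γ : x ≤ γ c
    x≤γ = let (i , 1≤i , i≤c , Mmax≡x) = x∈ in
          subst (_≤ γ c) Mmax≡x (maxEntry≤γ c i i≤c (≤-trans 1≤i i≤c) (ζ≤n (suc j)))
    below-or-above : (InColumn c x × x < e) ⊎ e ≤ x
    below-or-above with e ≤? x
    ... | yes e≤x = inj₂ e≤x
    ... | no e≰x = inj₁ (x∈ , ≰⇒> e≰x)

  column-inclusion : ∀ l j → 1 ≤ l → l ≤ j → j ≤ lam 1 →
                     ∀ x → InColumn (ζ n lam j) x → InColumn (ζ n lam l) x
  column-inclusion l zero 1≤l l≤0 _ _ _ = ⊥-elim (<-irrefl refl (≤-trans 1≤l l≤0))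
  column-inclusion l (suc j) 1≤l l≤j+1 j<lam₁ x x∈ with m≤n⇒m<n∨m≡n l≤j+1
  ... | inj₂ refl = x∈
  ... | inj₁ (s≤s l≤j) = column-inclusion l j 1≤l l≤j (≤-trans (n≤1+n j) j<lam₁) x
                           (column-inclusion-step j (≤-trans 1≤l l≤j) j<lam₁ x x∈)

  M-key : Key n lam M
  M-key = proj₁ (proj₁ isM) , λ l j 1≤l l≤j j≤ x x∈ →
    inColumn⇒inB l 1≤l (≤-trans l≤j j≤) x
      (column-inclusion l j 1≤l l≤j j≤ x (inB⇒inColumn j (≤-trans 1≤l l≤j) j≤ x x∈))

  module AtCarrel (h : ℕ) (1≤h : 1 ≤ h) (h≤r : h ≤ r n lam) where
    c j : ℕ
    c = q n lam h
    j = lam (q n lam (suc h))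

    1≤c : 1 ≤ c
    1≤c = 1≤q h 1≤h h≤r

    c≤n : c ≤ n
    c≤n = <⇒≤ (q<n h h≤r)

    j<lam₁ : suc j ≤ lam 1
    j<lam₁ = ≤-trans (lam-drop-at-carrel h 1≤h h≤r) (lam≤lam₁ c 1≤c c≤n)

    M-at-carrel : M (suc j) c ≡ γ c
    M-at-carrel = begin
      M (suc j) c                 ≡⟨ M≡Mmax (suc j) c (s≤s z≤n , j<lam₁ , 1≤c , ≤-reflexive (sym ζ≡c)) ⟩
      maxEntry (ζ n lam (suc j)) c ≡⟨ cong (λ z → maxEntry z c) ζ≡c ⟩
      maxEntry c c                ≡⟨ maxEntry-last c 1≤c c≤n ⟩
      γ c                         ∎
      where
      open ≡-Reasoning
      ζ≡c : ζ n lam (suc j) ≡ c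
      ζ≡c = ζ-past-carrel h 1≤h h≤r

    in-next-column : ∀ y → InColumn c y → inB n lam M (suc j) y ≡ true
    in-next-column y y∈ = inColumn⇒inB (suc j) (s≤s z≤n) j<lam₁ y
                            (subst (λ z → InColumn z y) (sym (ζ-past-carrel h 1≤h h≤r)) y∈)

    Threshold : ℕ → Set
    Threshold e =
      (∀ y → 1 ≤ y → y ≤ γ c → inB n lam M j y ≡ true → (inB n lam M (suc j) y ≡ true × y < e) ⊎ e ≤ y)
      × (∀ y → 1 ≤ y → y ≤ γ c → e ≤ y → inB n lam M j y ≡ true)

    threshold-latent : j ≡ 0 → Threshold 1
    threshold-latent j≡0 = (λ y 1≤y _ _ → inj₂ 1≤y) , λ y 1≤y y≤γ _ →
      subst (λ z → inB n lam M z y ≡ true) (sym j≡0) (inB-latent y 1≤y (≤-trans y≤γ (γ≤n c 1≤c c≤n)))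

    threshold-step : 1 ≤ j → ∃[ e ] Threshold e
    threshold-step 1≤j with column-step-at-carrel h 1≤h h≤r
    ... | e , step = e , low , high
      where
      ζ≡c' : ζ n lam j ≡ q n lam (suc h)
      ζ≡c' = ζ-at-carrel-end h h≤r 1≤j
      low : ∀ y → 1 ≤ y → y ≤ γ c → inB n lam M j y ≡ true →
            (inB n lam M (suc j) y ≡ true × y < e) ⊎ e ≤ y
      low y _ y≤γ y∈ with Equivalence.to (step y y≤γ)
                            (subst (λ z → InColumn z y) ζ≡c' (inB⇒inColumn j 1≤j (≤-trans (n≤1+n j) j<lam₁) y y∈))
      ... | inj₁ (y∈c , y<e) = inj₁ (in-next-column y y∈c , y<e)
      ... | inj₂ e≤y = inj₂ e≤y
      high : ∀ y → 1 ≤ y → y ≤ γ c → e ≤ y → inB n lam M j y ≡ true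
      high y _ y≤γ e≤y = inColumn⇒inB j 1≤j (≤-trans (n≤1+n j) j<lam₁) y
        (subst (λ z → InColumn z y) (sym ζ≡c') (Equivalence.from (step y y≤γ) (inj₂ e≤y)))

    threshold : ∃[ e ] Threshold e
    threshold with j ≟ 0
    ... | yes j≡0 = 1 , threshold-latent j≡0
    ... | no j≢0 = threshold-step (n≢0⇒n>0 j≢0)

    largest-missing : (M (suc j) c ≡ γ c)
      × (∀ x → 1 ≤ x → x ≤ γ c → inB n lam M (suc j) x ≡ false →
          (x < γ c × inB n lam M j x ≡ true)
          ⇔ (count (λ y → not (inB n lam M (suc j) y)) x (γ c)
               < count (λ y → inB n lam M j y ∧ not (inB n lam M (suc j) y)) 0 (γ c ∸ 1)))
    largest-missing with threshold
    ... | e , low , high = M-at-carrel , threshold-count (inB n lam M j) (inB n lam M (suc j)) (γ c) e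
      (in-next-column (γ c) (c , 1≤c , ≤-refl , maxEntry-last c 1≤c c≤n)) low high

lemma9p1 : (n : ℕ) → 1 ≤ n → (lam : ℕ → ℕ) → Partition n lam →
    (γ : ℕ → ℕ) → Gapless n lam γ →
    (M : ℕ → ℕ → ℕ) → IsMλ n lam γ M →
    Key n lam M
    × (∀ h → 1 ≤ h → h ≤ r n lam →
        let j = lam (q n lam (suc h))
            g = γ (q n lam h)
            s = countᵇ (λ x → inB n lam M j x ∧ not (inB n lam M (suc j) x)) (ioc 0 (g ∸ 1))
        in (M (suc j) (q n lam h) ≡ g)
           × (∀ x → 1 ≤ x → x ≤ g → inB n lam M (suc j) x ≡ false →
               ((x < g × inB n lam M j x ≡ true)
                 ⇔ (countᵇ (λ y → not (inB n lam M (suc j) y)) (ioc x g) < s))))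
lemma9p1 n 1≤n lam part γ gapless M isM = M-key , AtCarrel.largest-missing
  where open KeyOfMaximum n 1≤n lam part γ gapless M isM
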